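{- Let $G=(V,E)$ be a directed graph and $k$ a nonnegative integer. Let $\mathcal{G}$ be the directed graph with vertex set $V\cup\{a\}$, where $a\notin V$ is a new vertex, and arc set $E\cup\{(a,v): v\in V\}$. Then $G$ contains a directed simple path of length $k$ if and only if $(\mathcal{G},\mathcal{B}=\{a\},\ell_p=k+1,\ell_c=0,t=k+1)$ is a yes-instance of Kidney Exchange.
   Context: Kidney Exchange: the input is $(\mathcal{G},\mathcal{B},\ell_p,\ell_c,t)$, where $\mathcal{G}=(\mathcal{V},\mathcal{A})$ is a directed graph without self-loops, $\mathcal{B}\subset\mathcal{V}$ is a set of altruistic vertices, and $\ell_p,\ell_c,t$ are nonnegative integers. The question is whether there exists a collection of pairwise vertex-disjoint subgraphs, each of which is either a directed cycle of length at most $\ell_c$ on non-altruistic vertices or a directed path $u_1,\dots,u_k$ with $u_1\in\mathcal{B}$, $u_2,\dots,u_k\in\mathcal{V}\setminus\mathcal{B}$ and length at most $\ell_p$, such that together they contain at least $t$ non-altruistic vertices. The length of a path or cycle is its number of edges. -}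

module Defs where

open import Data.Nat using (ℕ; zero; suc; _≤_; _≥_)
open import Data.Fin using (Fin; zero; suc)
open import Data.Bool using (Bool; true; false; not)
open import Data.List using (List; []; _∷_; length; concat; map; filterᵇ)
open import Data.List.Relation.Unary.All using (All)
open import Data.List.Relation.Unary.Unique.Propositional using (Unique)
open import Data.Unit using (⊤)
open import Data.Empty using (⊥)
open import Data.Product using (Σ; _×_; ∃; ∃-syntax)
open import Relation.Nullary using (¬_)
open import Relation.Binary.PropositionalEquality using (_≡_)

record Digraph : Set₁ where
  field
    n   : ℕ
    Arc : Fin n → Fin n → Set
open Digraph public

Vtx : Digraph → Set
Vtx G = Fin (n G)

Loopless : Digraph → Set
Loopless G = ∀ (v : Vtx G) → ¬ Arc G v v

Walk : (G : Digraph) → List (Vtx G) → Set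
Walk G []             = ⊤
Walk G (u ∷ [])       = ⊤
Walk G (u ∷ v ∷ vs)   = Arc G u v × Walk G (v ∷ vs)

last : {A : Set} → A → List A → A
last x []       = x
last x (y ∷ ys) = last y ys

-- A directed simple path u₀ u₁ … u_k (length k = number of arcs),
-- given by its vertex list u₀ ∷ us.
record SimplePath (G : Digraph) (u₀ : Vtx G) (us : List (Vtx G)) : Set where
  field
    walk     : Walk G (u₀ ∷ us)
    distinct : Unique (u₀ ∷ us)

HasSimplePathOfLength : Digraph → ℕ → Set
HasSimplePathOfLength G k =
  ∃[ u₀ ] ∃[ us ] (SimplePath G u₀ us × length us ≡ k)

-- A directed cycle u₀ u₁ … u_{m} u₀ of length m+1 (distinct vertices,
-- arcs u_i → u_{i+1} and u_m → u₀), given by the vertex list u₀ ∷ us.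
record Cycle (G : Digraph) (u₀ : Vtx G) (us : List (Vtx G)) : Set where
  field
    walk     : Walk G (u₀ ∷ us)
    closing  : Arc G (last u₀ us) u₀
    distinct : Unique (u₀ ∷ us)

data Piece (V : Set) : Set where
  path  : V → List V → Piece V
  cycle : V → List V → Piece V

vertices : {V : Set} → Piece V → List V
vertices (path u us)  = u ∷ us
vertices (cycle u us) = u ∷ us

ValidPiece : (G : Digraph) → (Vtx G → Bool) → ℕ → ℕ → Piece (Vtx G) → Set
ValidPiece G B ℓp ℓc (path u us) =
  SimplePath G u us × B u ≡ true × All (λ v → B v ≡ false) us × length us ≤ ℓp
ValidPiece G B ℓp ℓc (cycle u us) =
  Cycle G u us × All (λ v → B v ≡ false) (u ∷ us) × suc (length us) ≤ ℓc

KidneyExchangeYes : (G : Digraph) → (Vtx G → Bool) → ℕ → ℕ → ℕ → Set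
KidneyExchangeYes G B ℓp ℓc t =
  ∃[ ps ] (All (ValidPiece G B ℓp ℓc) ps
          × Unique (concat (map vertices ps))
          × length (filterᵇ (λ v → not (B v)) (concat (map vertices ps))) ≥ t)

-- The graph 𝒢: vertex set V ∪ {a} with a = zero (old vertex v ↦ suc v),
-- arcs E ∪ {(a , v) : v ∈ V}.
extend : Digraph → Digraph
extend G = record { n = suc (n G) ; Arc = A }
  where
    A : Fin (suc (n G)) → Fin (suc (n G)) → Set
    A zero    zero    = ⊥
    A zero    (suc v) = ⊤
    A (suc u) zero    = ⊥
    A (suc u) (suc v) = Arc G u v

altruistA : (G : Digraph) → Vtx (extend G) → Bool
altruistA G zero    = true
altruistA G (suc v) = false

{-# OPTIONS --safe #-}
-- A solution in 𝒢 with ℓc = 0 contains no cycle, and each of its paths starts at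
-- the only altruistic vertex a; by disjointness it is therefore a single path
-- a v₁ … v_m, which covers exactly the m non-altruistic vertices v₁ … v_m.
-- With ℓp = t = k + 1 this forces m = k + 1, and v₁ … v_m is a simple path of
-- length k in G, all of whose arcs are arcs of G.  Conversely, prefixing a
-- simple path of length k in G by a gives such a solution.
module Submission where

open import Defs
open import Data.Nat using (ℕ; suc; _≤_)
open import Data.Nat.Properties using (≤-refl; ≤-antisym; suc-injective)
open import Data.Fin using (zero; suc)
import Data.Fin.Properties as Fin
open import Data.Bool using (false; not)
open import Data.List using (List; []; _∷_; _++_; length; concat; map; filterᵇ)
open import Data.List.Properties using (length-map; concat-[_])
open import Data.List.Relation.Unary.All using (All; []; _∷_; universal)
open import Data.List.Relation.Unary.All.Properties using (map⁺; ++⁻ʳ)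
import Data.List.Relation.Unary.All as All
open import Data.List.Relation.Unary.AllPairs as AllPairs using (_∷_)
open import Data.List.Relation.Unary.Unique.Propositional using (Unique)
import Data.List.Relation.Unary.Unique.Propositional.Properties as Unique
open import Data.Unit using (tt)
open import Data.Empty using (⊥-elim)
open import Data.Product using (_×_; _,_; proj₂; ∃-syntax)
open import Function.Base using (_∘_)
open import Function.Bundles using (_⇔_; mk⇔)
open import Relation.Nullary using (¬_)
open import Relation.Binary.PropositionalEquality using (_≡_; _≢_; refl; sym; trans; cong; subst)

¬-unique-repeat : ∀ {A : Set} (x : A) xs ys → ¬ Unique (x ∷ xs ++ x ∷ ys)
¬-unique-repeat x xs ys (x∉ ∷ _) = All.head (++⁻ʳ xs x∉) refl

module _ (G : Digraph) where

  PathFromA : List (Vtx G) → Set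
  PathFromA vs = SimplePath (extend G) zero (map suc vs)

  lift-walk : ∀ vs → Walk G vs → Walk (extend G) (map suc vs)
  lift-walk []           _       = tt
  lift-walk (_ ∷ [])     _       = tt
  lift-walk (_ ∷ v ∷ vs) (e , w) = e , lift-walk (v ∷ vs) w

  lower-walk : ∀ vs → Walk (extend G) (map suc vs) → Walk G vs
  lower-walk []           _       = tt
  lower-walk (_ ∷ [])     _       = tt
  lower-walk (_ ∷ v ∷ vs) (e , w) = e , lower-walk (v ∷ vs) w

  a∉lifted : ∀ (vs : List (Vtx G)) → All (zero ≢_) (map suc vs)
  a∉lifted vs = map⁺ (universal (λ _ ()) vs)

  lift-path : ∀ {u us} → SimplePath G u us → PathFromA (u ∷ us)
  lift-path {u} {us} p = record
    { walk     = tt , lift-walk (u ∷ us) (SimplePath.walk p)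
    ; distinct = a∉lifted (u ∷ us) ∷ Unique.map⁺ Fin.suc-injective (SimplePath.distinct p)
    }

  lower-path : ∀ {u us} → PathFromA (u ∷ us) → SimplePath G u us
  lower-path {u} {us} p = record
    { walk     = lower-walk (u ∷ us) (proj₂ (SimplePath.walk p))
    ; distinct = Unique.map⁻ (AllPairs.tail (SimplePath.distinct p))
    }

  lifted-non-altruistic : ∀ (vs : List (Vtx G)) → All (λ v → altruistA G v ≡ false) (map suc vs)
  lifted-non-altruistic vs = map⁺ (universal (λ _ → refl) vs)

  non-altruistic⇒lifted : ∀ {ws} → All (λ w → altruistA G w ≡ false) ws → ∃[ vs ] ws ≡ map suc vs
  non-altruistic⇒lifted []                 = [] , refl
  non-altruistic⇒lifted {zero ∷ _}  (() ∷ _)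
  non-altruistic⇒lifted {suc v ∷ _} (_ ∷ rest) with non-altruistic⇒lifted rest
  ... | vs , refl = v ∷ vs , refl

  count-lifted : ∀ (vs : List (Vtx G)) → length (filterᵇ (not ∘ altruistA G) (map suc vs)) ≡ length vs
  count-lifted []       = refl
  count-lifted (_ ∷ vs) = cong suc (count-lifted vs)

  count-single-path-from-a : ∀ (vs : List (Vtx G)) →
    length (filterᵇ (not ∘ altruistA G) (concat (map vertices (path zero (map suc vs) ∷ [])))) ≡ length vs
  count-single-path-from-a vs =
    trans (cong (length ∘ filterᵇ (not ∘ altruistA G)) concat-[ map suc vs ]) (count-lifted vs)

  valid-piece⇒path-from-a : ∀ {ℓp p} → ValidPiece (extend G) (altruistA G) ℓp 0 p →
    ∃[ vs ] (p ≡ path zero (map suc vs) × PathFromA vs × length vs ≤ ℓp)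
  valid-piece⇒path-from-a {p = cycle _ _}      (_ , _ , ())
  valid-piece⇒path-from-a {p = path (suc _) _} (_ , () , _)
  valid-piece⇒path-from-a {ℓp} {path zero _}   (p , _ , old , len) with non-altruistic⇒lifted old
  ... | vs , refl = vs , refl , p , subst (_≤ ℓp) (length-map suc vs) len

  path-from-a⇒solution : ∀ {ℓp ℓc t vs} → PathFromA vs → length vs ≤ ℓp → t ≤ length vs →
    KidneyExchangeYes (extend G) (altruistA G) ℓp ℓc t
  path-from-a⇒solution {ℓp} {t = t} {vs} p len count =
    path zero (map suc vs) ∷ [] ,
    (p , refl , lifted-non-altruistic vs , subst (_≤ ℓp) (sym (length-map suc vs)) len) ∷ [] ,
    subst Unique (sym concat-[ zero ∷ map suc vs ]) (SimplePath.distinct p) ,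
    subst (t ≤_) (sym (count-single-path-from-a vs)) count

  solution⇒path-from-a : ∀ {ℓp t} → KidneyExchangeYes (extend G) (altruistA G) ℓp 0 (suc t) →
    ∃[ vs ] (PathFromA vs × length vs ≤ ℓp × suc t ≤ length vs)
  solution⇒path-from-a ([] , _ , _ , ())
  solution⇒path-from-a (_ ∷ _ ∷ _ , valid₁ ∷ valid₂ ∷ _ , unique , _)
    with valid-piece⇒path-from-a valid₁ | valid-piece⇒path-from-a valid₂
  ... | vs , refl , _ | ws , refl , _ = ⊥-elim (¬-unique-repeat zero (map suc vs) _ unique)
  solution⇒path-from-a {t = t} (_ ∷ [] , valid ∷ [] , _ , count) with valid-piece⇒path-from-a valid
  ... | vs , refl , p , len = vs , p , len , subst (suc t ≤_) (count-single-path-from-a vs) count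

mainTheorem3 : (G : Digraph) → Loopless G → (k : ℕ) →
    HasSimplePathOfLength G k ⇔
      KidneyExchangeYes (extend G) (altruistA G) (suc k) 0 (suc k)
mainTheorem3 G _ k = mk⇔ to from
  where
  to : HasSimplePathOfLength G k → KidneyExchangeYes (extend G) (altruistA G) (suc k) 0 (suc k)
  to (_ , _ , p , refl) = path-from-a⇒solution G (lift-path G p) ≤-refl ≤-refl

  from : KidneyExchangeYes (extend G) (altruistA G) (suc k) 0 (suc k) → HasSimplePathOfLength G k
  from solution with solution⇒path-from-a G solution
  ... | [] , _ , _ , ()
  ... | v ∷ vs , p , len≤ , len≥ = v , vs , lower-path G p , suc-injective (≤-antisym len≤ len≥)
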